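{- Let $G$ be a finite graph with threshold assignment $\tau$, and let $l$ be the length of a longest path in $G$. Let $D$ be any $\tau$-WDM of $G$ with processing time $t$. (i) If $\tau(v)\geq 2$ for every vertex $v$, then $t\leq l/2$. (ii) If $\tau$ is the strict majority threshold assignment, then $t\leq (l+2)/2$.
   Context: All graphs are finite and simple. A set $D\subseteq V(G)$ is a $\tau$-weak dynamic monopoly ($\tau$-WDM) with processing time $t$ if $V(G)$ can be partitioned into nonempty sets $D_0=D,D_1,\ldots,D_t$ such that for every $i\in\{1,\ldots,t\}$, every vertex $v\in D_i$ has at least $\tau(v)$ neighbors in $D_{i-1}$. The strict majority threshold assignment is $\tau(v)=\lceil(\deg(v)+1)/2\rceil$. The length of a path is its number of edges. -}

module Defs where

open import Data.Nat using (ℕ; zero; suc; _+_; _∸_; _≤_; _/_)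
open import Data.Bool using (Bool; true; false; if_then_else_; _∧_)
open import Data.Fin using (Fin; zero; suc; inject₁; _≟_)
open import Data.List using (List; []; _∷_; length)
open import Data.List.Relation.Unary.Unique.Propositional using (Unique)
open import Data.Product using (Σ; ∃; _×_; _,_)
open import Relation.Binary.PropositionalEquality using (_≡_)
open import Relation.Nullary.Decidable using (⌊_⌋)
open import Data.Unit using (⊤)
open import Function using (_∘_; _⇔_)

record Graph (n : ℕ) : Set where
  field
    adj    : Fin n → Fin n → Bool
    sym    : ∀ u v → adj u v ≡ adj v u
    irrefl : ∀ v → adj v v ≡ false
open Graph public

count : ∀ {n} → (Fin n → Bool) → ℕ
count {zero}  p = 0
count {suc n} p = (if p zero then 1 else 0) + count (p ∘ suc)

deg : ∀ {n} → Graph n → Fin n → ℕ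
deg G v = count (adj G v)

Threshold : ℕ → Set
Threshold n = Fin n → ℕ

-- strict majority: τ(v) = ⌈(deg v + 1)/2⌉ = ⌊(deg v + 2)/2⌋
strictMajority : ∀ {n} → Graph n → Threshold n
strictMajority G v = (deg G v + 2) / 2

-- D is a τ-WDM with processing time t: a partition of V into nonempty
-- D₀ = D, D₁, …, D_t given by a labelling f : V → Fin (suc t) (v ∈ D_{f v}),
-- such that each v ∈ D_{i+1} has ≥ τ(v) neighbours in D_i.
record IsWDM {n : ℕ} (G : Graph n) (τ : Threshold n) (D : Fin n → Bool) (t : ℕ) : Set where
  field
    level    : Fin n → Fin (suc t)
    D₀≡D     : ∀ v → (D v ≡ true) ⇔ (level v ≡ zero)
    nonempty : ∀ (i : Fin (suc t)) → ∃ λ v → level v ≡ i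
    activate : ∀ v (i : Fin t) → level v ≡ suc i →
               τ v ≤ count (λ u → adj G v u ∧ ⌊ level u ≟ inject₁ i ⌋)

Walk : ∀ {n} → Graph n → List (Fin n) → Set
Walk G []           = ⊤
Walk G (v ∷ [])     = ⊤
Walk G (u ∷ v ∷ vs) = (adj G u v ≡ true) × Walk G (v ∷ vs)

IsPath : ∀ {n} → Graph n → List (Fin n) → Set
IsPath G p = (1 ≤ length p) × Unique p × Walk G p

pathLength : ∀ {A : Set} → List A → ℕ
pathLength p = length p ∸ 1

IsLongestPathLength : ∀ {n} → Graph n → ℕ → Set
IsLongestPathLength G l =
  (∃ λ p → IsPath G p × pathLength p ≡ l) ×
  (∀ p → IsPath G p → pathLength p ≤ l)

module Submission where

-- Read the partition D₀, …, D_t as a level function on vertices.  Call a vertex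
-- *good* if it lies on level 0 or has threshold at least 2.  A good vertex on
-- level i+1 has at least two neighbours on level i, so for any forbidden vertex z
-- it has a neighbour on level i other than z; if moreover that neighbour is again
-- good ("descent"), then from a good vertex v on level k we can grow two chains
-- v = b_k, …, b_0 and v = c_k, …, c_0 descending one level per step with
-- b_i ≠ c_i for all i < k.  Vertices on different levels differ, so the chains
-- meet only in v, and c_0 … c_{k-1} v b_{k-1} … b_0 is a path of length 2k.
--
-- For a
-- WDM, descent holds as soon as every vertex with a neighbour one level above it
-- has threshold ≥ 2.  This is immediate in case (i), where moreover the top
-- vertex is good; in case (ii) it follows from the strict majority rule, and a
-- lower neighbour of the top vertex is good, which costs the extra 2 in the bound.

open import Defs
open import Data.Nat using (ℕ; zero; suc; _≤_; _<_; _+_; _*_; _∸_; _/_; z≤n; s≤s; s≤s⁻¹)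
open import Data.Nat.Properties
  using (≤-trans; ≤-reflexive; <-trans; <-irrefl; m≤n⇒m≤1+n; m≤n+m; +-suc; +-identityʳ;
         *-suc; +-comm; +-monoʳ-≤; suc-injective; m≢1+n+m;
         module ≤-Reasoning)
open import Data.Nat.DivMod using (/-monoˡ-≤)
open import Data.Bool using (Bool; true; false; _∧_)
open import Data.Fin using (Fin; zero; suc; toℕ; inject₁; fromℕ; _≟_)
open import Data.Fin.Properties using (toℕ-inject₁; toℕ-fromℕ)
import Data.Fin.Properties as Fin
open import Data.List using (List; []; _∷_; _++_; _∷ʳ_; [_]; length; reverse)
open import Data.List.Properties using (unfold-reverse; ++-assoc; length-++; length-reverse)
open import Data.List.Membership.Propositional using (_∈_)
open import Data.List.Relation.Unary.Any using (here; there)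
import Data.List.Relation.Unary.Any.Properties as Any
import Data.List.Relation.Unary.All as All
open import Data.List.Relation.Unary.AllPairs using ([]; _∷_)
open import Data.List.Relation.Unary.Unique.Propositional using (Unique)
import Data.List.Relation.Unary.Unique.Propositional.Properties as Unique
open import Data.List.Relation.Binary.Disjoint.Propositional using (Disjoint)
import Data.List.Relation.Binary.Permutation.Setoid as Permutation
import Data.List.Relation.Binary.Permutation.Setoid.Properties as Perm
open import Data.Product using (_×_; ∃; ∃₂; _,_; proj₁; proj₂)
open import Data.Sum using (_⊎_; inj₁; inj₂)
open import Data.Empty using (⊥; ⊥-elim)
open import Data.Unit using (tt)
open import Relation.Binary.PropositionalEquality
  using (_≡_; _≢_; refl; trans; cong; cong₂; subst; setoid; module ≡-Reasoning)
import Relation.Binary.PropositionalEquality as ≡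
open import Relation.Nullary using (¬_; yes; no)
open import Relation.Nullary.Decidable using (⌊_⌋)
open import Function using (_∘_)

count-witness : ∀ {n} (p : Fin n → Bool) → 1 ≤ count p → ∃ λ u → p u ≡ true
count-witness {suc n} p h with p zero in p0
... | true  = zero , p0
... | false = let u , pu = count-witness (p ∘ suc) h in suc u , pu

count-avoid : ∀ {n} (p : Fin n → Bool) → 2 ≤ count p → ∀ z → ∃ λ u → p u ≡ true × u ≢ z
count-avoid {suc n} p h z with p zero in p0 | z
... | true  | suc _ = zero , p0 , λ ()
... | true  | zero  = let u , pu = count-witness (p ∘ suc) (s≤s⁻¹ h) in suc u , pu , λ ()
... | false | zero  = let u , pu = count-witness (p ∘ suc) (≤-trans (s≤s z≤n) h) in suc u , pu , λ ()
... | false | suc z′ =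
  let u , pu , u≢z′ = count-avoid (p ∘ suc) h z′ in suc u , pu , λ e → u≢z′ (Fin.suc-injective e)

_⊆ᵇ_ : ∀ {n} → (Fin n → Bool) → (Fin n → Bool) → Set
q ⊆ᵇ p = ∀ u → q u ≡ true → p u ≡ true

count-mono : ∀ {n} (p q : Fin n → Bool) → q ⊆ᵇ p → count q ≤ count p
count-mono {zero}  p q q⊆p = z≤n
count-mono {suc n} p q q⊆p with q zero in q0 | p zero in p0
... | true  | true  = s≤s (count-mono _ _ (q⊆p ∘ suc))
... | true  | false with () ← trans (≡.sym (q⊆p zero q0)) p0
... | false | true  = m≤n⇒m≤1+n (count-mono _ _ (q⊆p ∘ suc))
... | false | false = count-mono _ _ (q⊆p ∘ suc)

count-strict : ∀ {n} (p q : Fin n → Bool) → q ⊆ᵇ p →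
               ∀ w → p w ≡ true → ¬ (q w ≡ true) → count q < count p
count-strict {suc n} p q q⊆p zero pw ¬qw with q zero | p zero
... | true  | _ = ⊥-elim (¬qw refl)
... | false | true = s≤s (count-mono _ _ (q⊆p ∘ suc))
... | false | false with () ← pw
count-strict {suc n} p q q⊆p (suc w) pw ¬qw
  with count-strict (p ∘ suc) (q ∘ suc) (q⊆p ∘ suc) w pw ¬qw | q zero in q0 | p zero in p0
... | rest | true  | true  = s≤s rest
... | rest | true  | false with () ← trans (≡.sym (q⊆p zero q0)) p0
... | rest | false | true  = m≤n⇒m≤1+n rest
... | rest | false | false = rest

unique-reverse : ∀ {A : Set} {xs : List A} → Unique xs → Unique (reverse xs)
unique-reverse {A} {xs} = Unique-resp-↭ (↭-sym (↭-reverse xs))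
  where
    open Permutation (setoid A) using (↭-sym)
    open Perm (setoid A) using (Unique-resp-↭; ↭-reverse)

module _ {n} (G : Graph n) where

  walk-++ : ∀ xs {x ys} → Walk G (xs ∷ʳ x) → Walk G (x ∷ ys) → Walk G (xs ++ x ∷ ys)
  walk-++ []           _         w = w
  walk-++ (a ∷ [])     (ax , _)  w = ax , w
  walk-++ (a ∷ b ∷ xs) (ab , w₁) w = ab , walk-++ (b ∷ xs) w₁ w

  walk-reverse : ∀ xs → Walk G xs → Walk G (reverse xs)
  walk-reverse []           _        = tt
  walk-reverse (a ∷ [])     _        = tt
  walk-reverse (a ∷ b ∷ xs) (ab , w) = subst (Walk G) (≡.sym split) (joined (walk-reverse (b ∷ xs) w))
    where
      open ≡-Reasoning
      split : reverse (a ∷ b ∷ xs) ≡ reverse xs ++ b ∷ a ∷ []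
      split = begin
        reverse (a ∷ b ∷ xs)      ≡⟨ unfold-reverse a (b ∷ xs) ⟩
        reverse (b ∷ xs) ∷ʳ a     ≡⟨ cong (_∷ʳ a) (unfold-reverse b xs) ⟩
        (reverse xs ∷ʳ b) ∷ʳ a    ≡⟨ ++-assoc (reverse xs) [ b ] [ a ] ⟩
        reverse xs ++ b ∷ a ∷ []  ∎
      joined : Walk G (reverse (b ∷ xs)) → Walk G (reverse xs ++ b ∷ a ∷ [])
      joined w′ = walk-++ (reverse xs) (subst (Walk G) (unfold-reverse b xs) w′)
                    (trans (Graph.sym G b a) ab , tt)

  glue-walks : ∀ {x B C} → Walk G (x ∷ B) → Walk G (x ∷ C) →
               Unique (x ∷ B) → Unique (x ∷ C) → Disjoint B C →
               IsPath G (reverse C ++ x ∷ B) × length (reverse C ++ x ∷ B) ≡ length C + suc (length B)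
  glue-walks {x} {B} {C} wB wC uB (x∉C ∷ uC) B#C =
    (nonempty , unique , walk) , size
    where
      size : length (reverse C ++ x ∷ B) ≡ length C + suc (length B)
      size = trans (length-++ (reverse C)) (cong (_+ suc (length B)) (length-reverse C))
      nonempty : 1 ≤ length (reverse C ++ x ∷ B)
      nonempty = subst (1 ≤_) (≡.sym size) (≤-trans (s≤s z≤n) (m≤n+m (suc (length B)) (length C)))
      walk : Walk G (reverse C ++ x ∷ B)
      walk = walk-++ (reverse C) (subst (Walk G) (unfold-reverse x C) (walk-reverse (x ∷ C) wC)) wB
      disjoint : Disjoint (reverse C) (x ∷ B)
      disjoint (u∈C′ , here refl)  = All.lookup x∉C (Any.reverse⁻ u∈C′) refl
      disjoint (u∈C′ , there u∈B) = B#C (u∈B , Any.reverse⁻ u∈C′)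
      unique : Unique (reverse C ++ x ∷ B)
      unique = Unique.++⁺ (unique-reverse uC) uB disjoint

module Chains {n} (G : Graph n) (lv : Fin n → ℕ) where

  data Chain : Fin n → List (Fin n) → Set where
    bottom : ∀ {x} → lv x ≡ 0 → Chain x []
    down   : ∀ {x y B} → adj G x y ≡ true → lv x ≡ suc (lv y) → Chain y B → Chain x (y ∷ B)

  chain-walk : ∀ {x B} → Chain x B → Walk G (x ∷ B)
  chain-walk (bottom _)        = tt
  chain-walk (down xy _ chain) = xy , chain-walk chain

  chain-length : ∀ {x B} → Chain x B → length B ≡ lv x
  chain-length (bottom x0)       = ≡.sym x0
  chain-length (down _ lx chain) = trans (cong suc (chain-length chain)) (≡.sym lx)

  chain-below : ∀ {x B u} → Chain x B → u ∈ B → lv u < lv x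
  chain-below (down _ lx chain) (here refl) = ≤-reflexive (≡.sym lx)
  chain-below (down _ lx chain) (there u∈B) = <-trans (chain-below chain u∈B) (≤-reflexive (≡.sym lx))

  chain-unique : ∀ {x B} → Chain x B → Unique (x ∷ B)
  chain-unique (bottom _)             = All.[] ∷ []
  chain-unique whole@(down _ _ chain) =
    All.tabulate (λ u∈B x≡u → <-irrefl (cong lv (≡.sym x≡u)) (chain-below whole u∈B))
    ∷ chain-unique chain

  Descent : (Fin n → Set) → Set
  Descent Good = ∀ a i → Good a → lv a ≡ suc i → ∀ z →
                 ∃ λ b → adj G a b ≡ true × lv b ≡ i × b ≢ z × Good b

  module _ {Good : Fin n → Set} (descend : Descent Good) where

    -- Two Good vertices on the same level k start chains that are disjoint: at
    -- every level the second chain steps to a vertex other than the first chain's.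
    twin-chains : ∀ k b c → lv b ≡ k → lv c ≡ k → Good b → Good c →
                  ∃₂ λ B C → Chain b B × Chain c C × Disjoint B C
    twin-chains zero b c lb lc _ _ = [] , [] , bottom lb , bottom lc , λ { (() , _) }
    twin-chains (suc i) b c lb lc gb gc
      with descend b i gb lb b
    ... | b′ , bb′ , lb′ , _ , gb′
      with descend c i gc lc b′
    ... | c′ , cc′ , lc′ , c′≢b′ , gc′
      with twin-chains i b′ c′ lb′ lc′ gb′ gc′
    ... | B , C , chainB , chainC , B#C =
      b′ ∷ B , c′ ∷ C ,
      down bb′ (trans lb (cong suc (≡.sym lb′))) chainB ,
      down cc′ (trans lc (cong suc (≡.sym lc′))) chainC ,
      disjoint
      where
        not-below : ∀ {x X u} → Chain x X → lv x ≡ i → u ∈ X → lv u ≡ i → ⊥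
        not-below chain lx u∈X lu = <-irrefl (trans lu (≡.sym lx)) (chain-below chain u∈X)
        disjoint : Disjoint (b′ ∷ B) (c′ ∷ C)
        disjoint (here refl , here b′≡c′) = c′≢b′ (≡.sym b′≡c′)
        disjoint (here refl , there b′∈C) = not-below chainC lc′ b′∈C lb′
        disjoint (there u∈B , here refl)  = not-below chainB lb′ u∈B lc′
        disjoint (there u∈B , there u∈C)  = B#C (u∈B , u∈C)

    long-path : ∀ v → Good v → ∃ λ L → IsPath G L × pathLength L ≡ 2 * lv v
    long-path v gv with twin-chains (lv v) v v refl refl gv gv
    ... | B , C , chainB , chainC , B#C
      with glue-walks G (chain-walk chainB) (chain-walk chainC)
                        (chain-unique chainB) (chain-unique chainC) B#C
    ... | path , size = _ , path , (begin
      length (reverse C ++ v ∷ B) ∸ 1      ≡⟨ cong (_∸ 1) size ⟩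
      length C + suc (length B) ∸ 1        ≡⟨ cong₂ (λ c b → c + suc b ∸ 1) (chain-length chainC) (chain-length chainB) ⟩
      lv v + suc (lv v) ∸ 1                ≡⟨ cong (_∸ 1) (+-suc (lv v) (lv v)) ⟩
      lv v + lv v                          ≡⟨ cong (lv v +_) (≡.sym (+-identityʳ (lv v))) ⟩
      2 * lv v                             ∎)
      where open ≡-Reasoning

module Levels {n} {G : Graph n} {τ : Threshold n} {D : Fin n → Bool} {t : ℕ}
              (W : IsWDM G τ D t) where
  open IsWDM W

  lv : Fin n → ℕ
  lv v = toℕ (level v)

  open Chains G lv public

  top-vertex : ∃ λ v → lv v ≡ t
  top-vertex = let v , level≡ = nonempty (fromℕ t) in v , trans (cong toℕ level≡) (toℕ-fromℕ t)

  LowerNeighbours : Fin n → ℕ → (Fin n → Bool) → Set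
  LowerNeighbours v i p = ∀ u → p u ≡ true → adj G v u ≡ true × lv u ≡ i

  activation : ∀ v i → lv v ≡ suc i → ∃ λ p → LowerNeighbours v i p × τ v ≤ count p
  activation v i lv≡ with level v in level≡
  ... | suc j = (λ u → adj G v u ∧ ⌊ level u ≟ inject₁ j ⌋) , lower , activate v j level≡
    where
      lower : LowerNeighbours v i (λ u → adj G v u ∧ ⌊ level u ≟ inject₁ j ⌋)
      lower u with adj G v u | level u ≟ inject₁ j
      ... | true  | yes lu≡j = λ _ → refl , trans (cong toℕ lu≡j) (trans (toℕ-inject₁ j) (suc-injective lv≡))
      ... | true  | no _     = λ ()
      ... | false | _        = λ ()

  lower-neighbour : ∀ v i → lv v ≡ suc i → 1 ≤ τ v → ∃ λ a → adj G v a ≡ true × lv a ≡ i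
  lower-neighbour v i lv≡ τ≥1 =
    let p , lower , τ≤ = activation v i lv≡
        a , pa = count-witness p (≤-trans τ≥1 τ≤)
    in a , lower a pa

  Good : Fin n → Set
  Good a = lv a ≡ 0 ⊎ 2 ≤ τ a

  UpperNeighbourForcesTwo : Set
  UpperNeighbourForcesTwo = ∀ a b i → adj G a b ≡ true → lv a ≡ suc i → lv b ≡ suc (suc i) → 2 ≤ τ a

  module _ (forces-two : UpperNeighbourForcesTwo) where

    lower-neighbour-good : ∀ b a i → adj G b a ≡ true → lv b ≡ suc i → lv a ≡ i → Good a
    lower-neighbour-good b a zero    ba lb la = inj₁ la
    lower-neighbour-good b a (suc i) ba lb la = inj₂ (forces-two a b i (trans (Graph.sym G a b) ba) la lb)

    -- Good vertices descend: τ a ≥ 2 lower neighbours leave one besides z.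
    descent : Descent Good
    descent a i (inj₁ la≡0) la≡ z with () ← trans (≡.sym la≡0) la≡
    descent a i (inj₂ τ≥2)  la≡ z =
      let p , lower , τ≤ = activation a i la≡
          b , pb , b≢z = count-avoid p (≤-trans τ≥2 τ≤) z
          ab , lb = lower b pb
      in b , ab , lb , b≢z , lower-neighbour-good a b i ab la≡ lb

    good-level-bound : ∀ {l} → (∀ p → IsPath G p → pathLength p ≤ l) → ∀ v → Good v → 2 * lv v ≤ l
    good-level-bound {l} longest v gv =
      let L , path , len = long-path descent v gv in subst (_≤ l) len (longest L path)

bound-threshold-two : ∀ {n} {G : Graph n} {l : ℕ} {D : Fin n → Bool} {t : ℕ} →
  (∀ p → IsPath G p → pathLength p ≤ l) →
  (τ : Threshold n) → (∀ v → 2 ≤ τ v) → IsWDM G τ D t → 2 * t ≤ l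
bound-threshold-two {l = l} longest τ τ≥2 W =
  let v , lv≡t = top-vertex in
  subst (λ k → 2 * k ≤ l) lv≡t (good-level-bound (λ a _ _ _ _ _ → τ≥2 a) longest v (inj₂ (τ≥2 v)))
  where open Levels W

majority-positive : ∀ d → 1 ≤ (d + 2) / 2
majority-positive d = /-monoˡ-≤ 2 (m≤n+m 2 d)

majority-two : ∀ d → (d + 2) / 2 < d → 2 ≤ (d + 2) / 2
majority-two zero          ()
majority-two (suc zero)    (s≤s ())
majority-two (suc (suc d)) _ = /-monoˡ-≤ 2 (s≤s (s≤s (m≤n+m 2 d)))

module StrictMajority {n} {G : Graph n} {D : Fin n → Bool} {t : ℕ}
                      (W : IsWDM G (strictMajority G) D t) where
  open Levels W

  -- Under strict majority, a vertex a on level i+1 has at least ⌊(deg a+2)/2⌋ neighbours on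
  -- level i; a further neighbour one level up makes this less than deg a, which
  -- forces the threshold up to 2.
  majority-forces-two : UpperNeighbourForcesTwo
  majority-forces-two a b i ab la lb with activation a i la
  ... | p , lower , τ≤ = majority-two (deg G a) (≤-trans (s≤s τ≤) fewer)
    where
      fewer : count p < deg G a
      fewer = count-strict (adj G a) p (λ u pu → proj₁ (lower u pu)) b ab
                (λ pb → m≢1+n+m i (trans (≡.sym (proj₂ (lower b pb))) lb))

  -- A vertex on level k+1 has (threshold ≥ 1) a neighbour on level k, which is
  -- Good, so twice its level k is at most l.
  majority-bound : ∀ {l} → (∀ p → IsPath G p → pathLength p ≤ l) → ∀ v k → lv v ≡ k → 2 * k ≤ l + 2
  majority-bound longest v zero    _   = z≤n
  majority-bound {l} longest v (suc k) lv≡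
    with lower-neighbour v k lv≡ (majority-positive (deg G v))
  ... | a , va , la = begin
    2 * suc k     ≡⟨ *-suc 2 k ⟩
    2 + 2 * k     ≡⟨ cong (λ m → 2 + 2 * m) (≡.sym la) ⟩
    2 + 2 * lv a  ≤⟨ +-monoʳ-≤ 2 (good-level-bound majority-forces-two longest a good) ⟩
    2 + l         ≡⟨ +-comm 2 l ⟩
    l + 2         ∎
    where
      open ≤-Reasoning
      good : Good a
      good = lower-neighbour-good majority-forces-two v a k va lv≡ la

corollary3 : ∀ {n : ℕ} (G : Graph n) (l : ℕ) (D : Fin n → Bool) (t : ℕ) →
    IsLongestPathLength G l →
    ((τ : Threshold n) → (∀ v → 2 ≤ τ v) → IsWDM G τ D t → 2 * t ≤ l) ×
    (IsWDM G (strictMajority G) D t → 2 * t ≤ l + 2)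
corollary3 G l D t (_ , longest) =
  bound-threshold-two longest ,
  λ W → let open StrictMajority W
            v , lv≡t = Levels.top-vertex W
        in majority-bound longest v t lv≡t
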